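{- Let $G$ and $H$ be finite transitive permutation groups on the same set $\Omega$ with $H\le G$. Then $\rho(G)\le\rho(H)$.
   Context: For a permutation group $K$ on $\Omega$, a subset $\mathcal{F}\subseteq K$ is intersecting if for all $g,h\in\mathcal{F}$ some $\omega\in\Omega$ has $\omega^g=\omega^h$. With $K_\omega$ a point stabilizer of maximum cardinality, the intersection density is $\rho(K)=\max\{|\mathcal{F}|/|K_\omega| : \mathcal{F}\subseteq K\text{ intersecting}\}$. -}

module Defs where

open import Data.Nat using (ℕ; suc; _⊔_; _*_; _≤_)
open import Data.Fin using (Fin)
open import Data.Fin.Properties using (_≟_)
open import Data.Vec using (Vec; lookup; tabulate)
open import Data.List using (List; length; filter; foldr; map; allFin)
open import Data.List.Membership.Propositional using (_∈_)
open import Data.List.Relation.Unary.Unique.Propositional using (Unique)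
open import Data.Product using (Σ; ∃; _×_)
open import Relation.Binary.PropositionalEquality using (_≡_)
open import Function.Definitions using (Injective)

-- The point set Ω is Fin n (finite). A permutation of Ω is stored as its
-- table of images: ω^g = lookup g ω, required to be injective (hence bijective).
Tbl : ℕ → Set
Tbl n = Vec (Fin n) n

IsPerm : ∀ {n} → Tbl n → Set
IsPerm {n} g = Injective _≡_ _≡_ (lookup g)

idP : ∀ {n} → Tbl n
idP = tabulate (λ i → i)

_·_ : ∀ {n} → Tbl n → Tbl n → Tbl n
g · h = tabulate (λ i → lookup h (lookup g i))

record PermGroup (n : ℕ) : Set where
  field
    elems   : List (Tbl n)
    unique  : Unique elems
    perm    : ∀ {g} → g ∈ elems → IsPerm g
    has-id  : idP ∈ elems
    closed  : ∀ {g h} → g ∈ elems → h ∈ elems → (g · h) ∈ elems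
    has-inv : ∀ {g} → g ∈ elems → Σ (Tbl n) λ h → h ∈ elems × (g · h ≡ idP)
open PermGroup public

Transitive : ∀ {n} → PermGroup n → Set
Transitive {n} K = ∀ (α β : Fin n) → ∃ λ g → g ∈ elems K × lookup g α ≡ β

_≤G_ : ∀ {n} → PermGroup n → PermGroup n → Set
H ≤G G = ∀ {g} → g ∈ elems H → g ∈ elems G

stabSize : ∀ {n} → PermGroup n → Fin n → ℕ
stabSize K ω = length (filter (λ g → lookup g ω ≟ ω) (elems K))

maxStab : ∀ {n} → PermGroup n → ℕ
maxStab {n} K = foldr _⊔_ 0 (map (stabSize K) (allFin n))

IntersectingIn : ∀ {n} → PermGroup n → List (Tbl n) → Set
IntersectingIn {n} K F =
  Unique F × (∀ {g} → g ∈ F → g ∈ elems K) ×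
  (∀ {g h} → g ∈ F → h ∈ F → ∃ λ (ω : Fin n) → lookup g ω ≡ lookup h ω)

-- ρ(G) ≤ ρ(H), where ρ(K) = max { |F| / maxStab K : F ⊆ K intersecting }.
-- Since the maxima over the finitely many intersecting sets exist, this is
-- exactly: every ratio for G is bounded by some ratio for H (cross-multiplied).
DensityLe : ∀ {n} → PermGroup n → PermGroup n → Set
DensityLe {n} G H =
  ∀ (F : List (Tbl n)) → IntersectingIn G F →
    ∃ λ (F' : List (Tbl n)) → IntersectingIn H F' ×
      (length F * maxStab H ≤ length F' * maxStab G)

{-# OPTIONS --safe #-}
-- Fix ω with |H_ω| maximal and, for f ∈ F, some h_f ∈ H with ω^(h_f) = ω^f (H is transitive).
-- The map (f , k) ↦ (f (k h_f)⁻¹ , k h_f) injects F × H_ω into the set of pairs (x , h) with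
-- x ∈ G_ω, h ∈ H and x h ∈ F, since f is recovered as x h and then k from k h_f.  For each x the
-- fibre {h ∈ H : x h ∈ F} is intersecting in H, so
--   |F| |H_ω| ≤ Σ_{x ∈ G_ω} |{h ∈ H : x h ∈ F}| ≤ |G_ω| |F'|
-- for the largest fibre F'.
module Submission where

open import Defs
open import Data.Nat using (ℕ; suc; _⊔_; _*_; _+_; _≤_; z≤n; s≤s)
open import Data.Nat.Properties
  using (≤-trans; ⊔-lub; m≤m⊔n; m≤n⊔m; +-mono-≤; *-monoˡ-≤; *-monoʳ-≤; *-comm; module ≤-Reasoning)
open import Data.Fin using (Fin; zero)
open import Data.Fin.Properties using (_≟_)
open import Data.Vec using (lookup)
open import Data.Vec.Properties using (lookup∘tabulate; tabulate∘lookup; tabulate-cong; ≡-dec)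
open import Data.List using (List; []; _∷_; _++_; length; filter; foldr; map; concatMap; allFin; cartesianProduct)
open import Data.List.Properties using (length-++; length-map; length-++-sucʳ)
open import Data.List.Extrema.Nat using (argmax; f[xs]≤f[argmax])
open import Data.List.Membership.Propositional using (_∈_)
open import Data.List.Membership.Propositional.Properties
  using (∈-∃++; ∈-++⁻; ∈-++⁺ˡ; ∈-++⁺ʳ; ∈-map⁺; ∈-filter⁺; ∈-filter⁻; ∈-cartesianProduct⁻; ∈-allFin)
import Data.List.Membership.DecPropositional as DecMembership
open import Data.List.Relation.Unary.All as All using (All; []; _∷_)
open import Data.List.Relation.Unary.Any using (here; there)
open import Data.List.Relation.Unary.AllPairs using (_∷_)
open import Data.List.Relation.Unary.Unique.Propositional using (Unique)
open import Data.List.Relation.Unary.Unique.Propositional.Properties using (cartesianProduct⁺; filter⁺)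
open import Data.Product using (∃; _×_; _,_; proj₁; proj₂)
open import Data.Sum using (inj₁; inj₂)
open import Relation.Binary.PropositionalEquality using (_≡_; refl; sym; trans; cong; cong₂; subst; module ≡-Reasoning)
open import Relation.Nullary using (Dec; yes; no; contradiction)

module _ {A B : Set} where

  length-≤-injectiveOn : (φ : A → B) {xs : List A} {ys : List B} → Unique xs →
                         (∀ {a} → a ∈ xs → φ a ∈ ys) →
                         (∀ {a b} → a ∈ xs → b ∈ xs → φ a ≡ φ b → a ≡ b) →
                         length xs ≤ length ys
  length-≤-injectiveOn φ {[]} _ _ _ = z≤n
  length-≤-injectiveOn φ {a ∷ xs} (a∉xs ∷ xs-unique) into injective
    with ys₁ , ys₂ , refl ← ∈-∃++ (into (here refl)) = begin
      suc (length xs)           ≤⟨ s≤s (length-≤-injectiveOn φ xs-unique into′ injective′) ⟩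
      suc (length (ys₁ ++ ys₂)) ≡⟨ sym (length-++-sucʳ ys₁ (φ a) ys₂) ⟩
      length (ys₁ ++ φ a ∷ ys₂) ∎
    where
    open ≤-Reasoning
    into′ : ∀ {b} → b ∈ xs → φ b ∈ ys₁ ++ ys₂
    into′ b∈xs with ∈-++⁻ ys₁ (into (there b∈xs))
    ... | inj₁ φb∈ys₁         = ∈-++⁺ˡ φb∈ys₁
    ... | inj₂ (here φb≡φa)   = contradiction (sym (injective (there b∈xs) (here refl) φb≡φa))
                                              (All.lookup a∉xs b∈xs)
    ... | inj₂ (there φb∈ys₂) = ∈-++⁺ʳ ys₁ φb∈ys₂
    injective′ : ∀ {b c} → b ∈ xs → c ∈ xs → φ b ≡ φ c → b ≡ c
    injective′ b∈xs c∈xs = injective (there b∈xs) (there c∈xs)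

  length-cartesianProduct : (xs : List A) (ys : List B) →
                            length (cartesianProduct xs ys) ≡ length xs * length ys
  length-cartesianProduct []       ys = refl
  length-cartesianProduct (x ∷ xs) ys = begin
    length (map (x ,_) ys ++ cartesianProduct xs ys)          ≡⟨ length-++ (map (x ,_) ys) ⟩
    length (map (x ,_) ys) + length (cartesianProduct xs ys)  ≡⟨ cong₂ _+_ (length-map (x ,_) ys)
                                                                          (length-cartesianProduct xs ys) ⟩
    length ys + length xs * length ys                         ∎
    where open ≡-Reasoning

  pairsOver : List A → (A → List B) → List (A × B)
  pairsOver xs f = concatMap (λ x → map (x ,_) (f x)) xs

  module _ {f : A → List B} where

    ∈-pairsOver⁺ : ∀ {x y xs} → x ∈ xs → y ∈ f x → (x , y) ∈ pairsOver xs f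
    ∈-pairsOver⁺ {x} (here refl) y∈fx = ∈-++⁺ˡ (∈-map⁺ (x ,_) y∈fx)
    ∈-pairsOver⁺ {xs = x′ ∷ _} (there x∈xs) y∈fx =
      ∈-++⁺ʳ (map (x′ ,_) (f x′)) (∈-pairsOver⁺ x∈xs y∈fx)

    length-pairsOver-≤ : ∀ {c} xs → All (λ x → length (f x) ≤ c) xs →
                         length (pairsOver xs f) ≤ length xs * c
    length-pairsOver-≤ []       []               = z≤n
    length-pairsOver-≤ {c} (x ∷ xs) (fx≤c ∷ fxs≤c) = begin
      length (map (x ,_) (f x) ++ pairsOver xs f)          ≡⟨ length-++ (map (x ,_) (f x)) ⟩
      length (map (x ,_) (f x)) + length (pairsOver xs f)  ≡⟨ cong (_+ length (pairsOver xs f))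
                                                                   (length-map (x ,_) (f x)) ⟩
      length (f x) + length (pairsOver xs f)               ≤⟨ +-mono-≤ fx≤c (length-pairsOver-≤ xs fxs≤c) ⟩
      c + length xs * c                                    ∎
      where open ≤-Reasoning

module _ {A : Set} where

  ≤-foldr-⊔-map : (f : A → ℕ) {x : A} {xs : List A} → x ∈ xs → f x ≤ foldr _⊔_ 0 (map f xs)
  ≤-foldr-⊔-map f {xs = y ∷ _} (here refl) = m≤m⊔n (f y) _
  ≤-foldr-⊔-map f {xs = y ∷ _} (there x∈xs) = ≤-trans (≤-foldr-⊔-map f x∈xs) (m≤n⊔m (f y) _)

  foldr-⊔-map-≤ : (f : A → ℕ) {c : ℕ} (xs : List A) → All (λ x → f x ≤ c) xs →
                  foldr _⊔_ 0 (map f xs) ≤ c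
  foldr-⊔-map-≤ f []       []             = z≤n
  foldr-⊔-map-≤ f (_ ∷ xs) (fx≤c ∷ fxs≤c) = ⊔-lub fx≤c (foldr-⊔-map-≤ f xs fxs≤c)

module _ {m : ℕ} where

  open ≡-Reasoning

  lookup-· : (g h : Tbl m) (i : Fin m) → lookup (g · h) i ≡ lookup h (lookup g i)
  lookup-· g h = lookup∘tabulate _

  lookup-idP : (i : Fin m) → lookup (idP {m}) i ≡ i
  lookup-idP = lookup∘tabulate _

  Tbl-ext : {g h : Tbl m} → (∀ i → lookup g i ≡ lookup h i) → g ≡ h
  Tbl-ext {g} {h} g≗h = trans (sym (tabulate∘lookup g)) (trans (tabulate-cong g≗h) (tabulate∘lookup h))

  ·-assoc : (f g h : Tbl m) → (f · g) · h ≡ f · (g · h)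
  ·-assoc f g h = Tbl-ext λ i → begin
    lookup ((f · g) · h) i            ≡⟨ lookup-· (f · g) h i ⟩
    lookup h (lookup (f · g) i)       ≡⟨ cong (lookup h) (lookup-· f g i) ⟩
    lookup h (lookup g (lookup f i))  ≡⟨ sym (lookup-· g h (lookup f i)) ⟩
    lookup (g · h) (lookup f i)       ≡⟨ sym (lookup-· f (g · h) i) ⟩
    lookup (f · (g · h)) i            ∎

  ·-identityˡ : (g : Tbl m) → idP · g ≡ g
  ·-identityˡ g = Tbl-ext λ i → trans (lookup-· idP g i) (cong (lookup g) (lookup-idP i))

  ·-identityʳ : (g : Tbl m) → g · idP ≡ g
  ·-identityʳ g = Tbl-ext λ i → trans (lookup-· g idP i) (lookup-idP (lookup g i))

  ·-cancelʳ : {g g′ : Tbl m} (h : Tbl m) → IsPerm h → g · h ≡ g′ · h → g ≡ g′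
  ·-cancelʳ {g} {g′} h h-injective gh≡g′h = Tbl-ext λ i → h-injective (begin
    lookup h (lookup g i)   ≡⟨ sym (lookup-· g h i) ⟩
    lookup (g · h) i        ≡⟨ cong (λ t → lookup t i) gh≡g′h ⟩
    lookup (g′ · h) i       ≡⟨ lookup-· g′ h i ⟩
    lookup h (lookup g′ i)  ∎)

  inverseʳ⇒inverseˡ : (g u : Tbl m) → IsPerm u → g · u ≡ idP → u · g ≡ idP
  inverseʳ⇒inverseˡ g u u-injective gu≡idP = ·-cancelʳ u u-injective (begin
    (u · g) · u  ≡⟨ ·-assoc u g u ⟩
    u · (g · u)  ≡⟨ cong (u ·_) gu≡idP ⟩
    u · idP      ≡⟨ ·-identityʳ u ⟩
    u            ≡⟨ sym (·-identityˡ u) ⟩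
    idP · u      ∎)

  _∈?_ : (g : Tbl m) (xs : List (Tbl m)) → Dec (g ∈ xs)
  _∈?_ = DecMembership._∈?_ (≡-dec _≟_)

  -- The value outside K is junk; only inverses of members of K are ever used.
  inverseIn : PermGroup m → Tbl m → Tbl m
  inverseIn K g with g ∈? elems K
  ... | yes g∈K = proj₁ (has-inv K g∈K)
  ... | no  _   = g

  inverseIn-spec : (K : PermGroup m) {g : Tbl m} → g ∈ elems K →
                   inverseIn K g ∈ elems K × g · inverseIn K g ≡ idP
  inverseIn-spec K {g} g∈K with g ∈? elems K
  ... | yes g∈K′ = proj₂ (has-inv K g∈K′)
  ... | no  g∉K  = contradiction g∈K g∉K

  ·-inverseIn-cancelʳ : (K : PermGroup m) (g : Tbl m) {h : Tbl m} → h ∈ elems K →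
                         (g · inverseIn K h) · h ≡ g
  ·-inverseIn-cancelʳ K g {h} h∈K = begin
    (g · inverseIn K h) · h  ≡⟨ ·-assoc g (inverseIn K h) h ⟩
    g · (inverseIn K h · h)  ≡⟨ cong (g ·_)
                                  (inverseʳ⇒inverseˡ h (inverseIn K h) (perm K h⁻¹∈K) hh⁻¹≡idP) ⟩
    g · idP                  ≡⟨ ·-identityʳ g ⟩
    g                        ∎
    where
    h⁻¹∈K : inverseIn K h ∈ elems K
    h⁻¹∈K = proj₁ (inverseIn-spec K h∈K)
    hh⁻¹≡idP : h · inverseIn K h ≡ idP
    hh⁻¹≡idP = proj₂ (inverseIn-spec K h∈K)

  stabiliser : PermGroup m → Fin m → List (Tbl m)
  stabiliser K ω = filter (λ g → lookup g ω ≟ ω) (elems K)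

  ∈-stabiliser⁺ : (K : PermGroup m) {ω : Fin m} {g : Tbl m} →
                  g ∈ elems K → lookup g ω ≡ ω → g ∈ stabiliser K ω
  ∈-stabiliser⁺ K {ω} = ∈-filter⁺ (λ g → lookup g ω ≟ ω)

  ∈-stabiliser⁻ : (K : PermGroup m) {ω : Fin m} {g : Tbl m} →
                  g ∈ stabiliser K ω → g ∈ elems K × lookup g ω ≡ ω
  ∈-stabiliser⁻ K {ω} = ∈-filter⁻ (λ g → lookup g ω ≟ ω) {xs = elems K}

  translateIn : PermGroup m → Tbl m → List (Tbl m) → List (Tbl m)
  translateIn H x F = filter (λ h → (x · h) ∈? F) (elems H)

  ∈-translateIn⁺ : (H : PermGroup m) (x : Tbl m) {h : Tbl m} {F : List (Tbl m)} →
                   h ∈ elems H → x · h ∈ F → h ∈ translateIn H x F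
  ∈-translateIn⁺ H x {F = F} = ∈-filter⁺ (λ h → (x · h) ∈? F)

  ∈-translateIn⁻ : (H : PermGroup m) (x : Tbl m) {h : Tbl m} {F : List (Tbl m)} →
                   h ∈ translateIn H x F → h ∈ elems H × x · h ∈ F
  ∈-translateIn⁻ H x {F = F} = ∈-filter⁻ (λ h → (x · h) ∈? F) {xs = elems H}

  translateIn-intersecting : {G : PermGroup m} (H : PermGroup m) (x : Tbl m) {F : List (Tbl m)} →
                             IntersectingIn G F → IntersectingIn H (translateIn H x F)
  translateIn-intersecting H x {F} (_ , _ , F-agree) =
    filter⁺ _ (unique H) , (λ h∈T → proj₁ (∈-translateIn⁻ H x h∈T)) , agree
    where
    agree : ∀ {g h} → g ∈ translateIn H x F → h ∈ translateIn H x F →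
            ∃ λ (ω : Fin m) → lookup g ω ≡ lookup h ω
    agree {g} {h} g∈T h∈T
      with ω , xgω≡xhω ← F-agree (proj₂ (∈-translateIn⁻ H x g∈T)) (proj₂ (∈-translateIn⁻ H x h∈T))
      = lookup x ω , (begin
        lookup g (lookup x ω)  ≡⟨ sym (lookup-· x g ω) ⟩
        lookup (x · g) ω       ≡⟨ xgω≡xhω ⟩
        lookup (x · h) ω       ≡⟨ lookup-· x h ω ⟩
        lookup h (lookup x ω)  ∎)

  stabSize≤maxStab : (K : PermGroup m) (ω : Fin m) → stabSize K ω ≤ maxStab K
  stabSize≤maxStab K ω = ≤-foldr-⊔-map (stabSize K) (∈-allFin ω)

maxStab≤stabSize-argmax : ∀ {n} (K : PermGroup (suc n)) →
                          maxStab K ≤ stabSize K (argmax (stabSize K) zero (allFin (suc n)))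
maxStab≤stabSize-argmax {n} K =
  foldr-⊔-map-≤ (stabSize K) (allFin (suc n))
    (f[xs]≤f[argmax] {f = stabSize K} zero (allFin (suc n)))

module DoubleCounting {m : ℕ} (G H : PermGroup m) (H-transitive : Transitive H) (H≤G : H ≤G G)
                      (ω : Fin m) {F : List (Tbl m)} (F-intersecting : IntersectingIn G F) where

  transporter : Tbl m → Tbl m
  transporter f = proj₁ (H-transitive ω (lookup f ω))

  transporter-∈ : ∀ f → transporter f ∈ elems H
  transporter-∈ f = proj₁ (proj₂ (H-transitive ω (lookup f ω)))

  transporter-ω : ∀ f → lookup (transporter f) ω ≡ lookup f ω
  transporter-ω f = proj₂ (proj₂ (H-transitive ω (lookup f ω)))

  mover : Tbl m → Tbl m → Tbl m
  mover f k = k · transporter f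

  fixer : Tbl m → Tbl m → Tbl m
  fixer f k = f · inverseIn H (mover f k)

  encode : Tbl m × Tbl m → Tbl m × Tbl m
  encode (f , k) = fixer f k , mover f k

  Pairs : List (Tbl m × Tbl m)
  Pairs = cartesianProduct F (stabiliser H ω)

  Translates : List (Tbl m × Tbl m)
  Translates = pairsOver (stabiliser G ω) (λ x → translateIn H x F)

  module _ (f : Tbl m) {k : Tbl m} (k∈Hω : k ∈ stabiliser H ω) where

    open ≡-Reasoning

    mover-∈ : mover f k ∈ elems H
    mover-∈ = closed H (proj₁ (∈-stabiliser⁻ H k∈Hω)) (transporter-∈ f)

    mover-ω : lookup (mover f k) ω ≡ lookup f ω
    mover-ω = begin
      lookup (k · transporter f) ω        ≡⟨ lookup-· k (transporter f) ω ⟩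
      lookup (transporter f) (lookup k ω) ≡⟨ cong (lookup (transporter f))
                                                  (proj₂ (∈-stabiliser⁻ H k∈Hω)) ⟩
      lookup (transporter f) ω            ≡⟨ transporter-ω f ⟩
      lookup f ω                          ∎

    fixer-·-mover : fixer f k · mover f k ≡ f
    fixer-·-mover = ·-inverseIn-cancelʳ H f mover-∈

    fixer-ω : lookup (fixer f k) ω ≡ ω
    fixer-ω = begin
      lookup (f · u) ω                ≡⟨ lookup-· f u ω ⟩
      lookup u (lookup f ω)           ≡⟨ cong (lookup u) (sym mover-ω) ⟩
      lookup u (lookup (mover f k) ω) ≡⟨ sym (lookup-· (mover f k) u ω) ⟩
      lookup (mover f k · u) ω        ≡⟨ cong (λ t → lookup t ω) (proj₂ (inverseIn-spec H mover-∈)) ⟩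
      lookup idP ω                    ≡⟨ lookup-idP ω ⟩
      ω                               ∎
      where
      u : Tbl m
      u = inverseIn H (mover f k)

  encode-∈ : ∀ {p} → p ∈ Pairs → encode p ∈ Translates
  encode-∈ {f , k} p∈ = ∈-pairsOver⁺ fixer∈Gω mover∈T
    where
    f∈F : f ∈ F
    f∈F = proj₁ (∈-cartesianProduct⁻ F (stabiliser H ω) p∈)
    k∈Hω : k ∈ stabiliser H ω
    k∈Hω = proj₂ (∈-cartesianProduct⁻ F (stabiliser H ω) p∈)
    fixer∈G : fixer f k ∈ elems G
    fixer∈G = closed G (proj₁ (proj₂ F-intersecting) f∈F)
                       (H≤G (proj₁ (inverseIn-spec H (mover-∈ f k∈Hω))))
    fixer∈Gω : fixer f k ∈ stabiliser G ω
    fixer∈Gω = ∈-stabiliser⁺ G fixer∈G (fixer-ω f k∈Hω)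
    mover∈T : mover f k ∈ translateIn H (fixer f k) F
    mover∈T = ∈-translateIn⁺ H (fixer f k) (mover-∈ f k∈Hω)
                (subst (_∈ F) (sym (fixer-·-mover f k∈Hω)) f∈F)

  encode-injective : ∀ {p q} → p ∈ Pairs → q ∈ Pairs → encode p ≡ encode q → p ≡ q
  encode-injective {f , k} {f′ , k′} p∈ q∈ encp≡encq = cong₂ _,_ f≡f′ k≡k′
    where
    open ≡-Reasoning
    f≡f′ : f ≡ f′
    f≡f′ = begin
      f                         ≡⟨ sym (fixer-·-mover f (proj₂ (∈-cartesianProduct⁻ F _ p∈))) ⟩
      fixer f k · mover f k     ≡⟨ cong₂ _·_ (cong proj₁ encp≡encq) (cong proj₂ encp≡encq) ⟩
      fixer f′ k′ · mover f′ k′ ≡⟨ fixer-·-mover f′ (proj₂ (∈-cartesianProduct⁻ F _ q∈)) ⟩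
      f′                        ∎
    k≡k′ : k ≡ k′
    k≡k′ = ·-cancelʳ (transporter f) (perm H (transporter-∈ f))
             (trans (cong proj₂ encp≡encq) (cong (λ f″ → mover f″ k′) (sym f≡f′)))

  length*stabSize≤length-Translates : length F * stabSize H ω ≤ length Translates
  length*stabSize≤length-Translates = begin
    length F * stabSize H ω  ≡⟨ sym (length-cartesianProduct F (stabiliser H ω)) ⟩
    length Pairs             ≤⟨ length-≤-injectiveOn encode
                                  (cartesianProduct⁺ (proj₁ F-intersecting) (filter⁺ _ (unique H)))
                                  encode-∈ encode-injective ⟩
    length Translates        ∎
    where open ≤-Reasoning

lemma6p5 : ∀ (n : ℕ) (G H : PermGroup (suc n)) →
    Transitive G → Transitive H → H ≤G G → DensityLe G H
lemma6p5 n G H _ H-transitive H≤G F F-intersecting =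
  translateIn H x F , translateIn-intersecting {G = G} H x F-intersecting , (begin
    length F * maxStab H                       ≤⟨ *-monoʳ-≤ (length F) (maxStab≤stabSize-argmax H) ⟩
    length F * stabSize H ω                    ≤⟨ length*stabSize≤length-Translates ⟩
    length Translates                          ≤⟨ length-pairsOver-≤ (stabiliser G ω)
                                                    (f[xs]≤f[argmax] idP (stabiliser G ω)) ⟩
    stabSize G ω * length (translateIn H x F)  ≤⟨ *-monoˡ-≤ _ (stabSize≤maxStab G ω) ⟩
    maxStab G * length (translateIn H x F)     ≡⟨ *-comm (maxStab G) _ ⟩
    length (translateIn H x F) * maxStab G     ∎)
  where
  ω : Fin (suc n)
  ω = argmax (stabSize H) zero (allFin (suc n))
  open DoubleCounting G H H-transitive H≤G ω F-intersecting
  x : Tbl (suc n)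
  x = argmax (λ y → length (translateIn H y F)) idP (stabiliser G ω)
  open ≤-Reasoning
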